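{- Let $G=(X\cup Y,E)$ be a connected convex bipartite graph with a lex-convex ordering $\sigma=(x_1,\ldots,x_{n_1},y_1,\ldots,y_{n_2})$, and let $J_1$ be the first set of isolated vertices in the chain decomposition of $G$ with respect to $\sigma$. Let $y_{r'}=right(x_1)$ and $x_r=right(y_1)$. Then one of the following holds: (a) there exists a minimum VED-set $D$ of $G$ with $x_r\in D$; (b) there exists a minimum VED-set $D$ of $G$ with $y_\alpha\in D$, where $y_\alpha\in N_G(x_1)$ and $\alpha=\max\{i : 1\le i\le r' \text{ and } y_i \text{ is adjacent to every vertex of } J_1\}$.
   Context: All graphs are finite, simple, undirected. $N_G(v)$ denotes the neighbourhood of $v$, $N_G[v]=N_G(v)\cup\{v\}$. A set $D\subseteq V(G)$ is a vertex-edge dominating set (VED-set) if for every edge $uv$, $|(N_G[u]\cup N_G[v])\cap D|\ge 1$; a minimum VED-set is one of minimum cardinality. A bipartite graph $G=(X\cup Y,E)$ is convex if $Y$ can be ordered so that every $x\in X$ has consecutive neighbours in $Y$. Given an ordering $\sigma=(x_1,\ldots,x_{n_1},y_1,\ldots,y_{n_2})$, for a vertex $v$, $left(v)$ (resp. $right(v)$) denotes the neighbour of $v$ of minimum (resp. maximum) index in $\sigma$; comparisons $\prec,\preceq$ between such vertices refer to their indices. The ordering $\sigma$ is lex-convex if the ordering of $Y$ is convex and for all $i<j$ either $left(x_i)\prec left(x_j)$, or $left(x_i)=left(x_j)$ and $right(x_i)\preceq right(x_j)$. Chain decomposition: with $x_{t_1}=right(y_1)$, let $H_1$ be the (chain)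 subgraph induced by $N(y_1)\cup N(x_{t_1})$; remove $H_1$ from $G$; let $J_1$ be the set of vertices of $X$ that are isolated in $G[V(G)\setminus V(H_1)]$; remove $J_1$ and repeat on the remaining graph to obtain $H_2,J_2,\ldots$. -}

module Defs where

open import Data.Bool using (Bool; T)
open import Data.Nat using (ℕ; _+_)
open import Data.Fin using (Fin; _≤_; _<_)
open import Data.Fin.Subset using (Subset; _∈_; ∣_∣)
open import Data.Sum using (_⊎_; inj₁; inj₂)
open import Data.Product using (_×_; ∃)
open import Data.Empty using (⊥)
open import Relation.Nullary using (¬_)
open import Relation.Binary.PropositionalEquality using (_≡_)
open import Relation.Binary.Construct.Closure.ReflexiveTransitive using (Star)

-- A finite simple bipartite graph with colour classes X = {x_1..x_n₁} and
-- Y = {y_1..y_n₂}, given by its (bipartite) adjacency matrix.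
-- x_i is represented by the element (i-1) of Fin n₁, similarly for Y.
-- The ordering σ = (x_1,…,x_n₁,y_1,…,y_n₂) is the index order of Fin.
BGraph : ℕ → ℕ → Set
BGraph n₁ n₂ = Fin n₁ → Fin n₂ → Bool

module _ {n₁ n₂ : ℕ} (G : BGraph n₁ n₂) where

  Adj : Fin n₁ → Fin n₂ → Set
  Adj x y = T (G x y)

  Vertex : Set
  Vertex = Fin n₁ ⊎ Fin n₂

  Edge : Vertex → Vertex → Set
  Edge (inj₁ x) (inj₂ y) = Adj x y
  Edge (inj₂ y) (inj₁ x) = Adj x y
  Edge (inj₁ _) (inj₁ _) = ⊥
  Edge (inj₂ _) (inj₂ _) = ⊥

  Connected : Set
  Connected = ∀ (u v : Vertex) → Star Edge u v

  ConvexOrder : Set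
  ConvexOrder = ∀ (x : Fin n₁) {i j k : Fin n₂} →
    i ≤ j → j ≤ k → Adj x i → Adj x k → Adj x j

  IsLeftX : Fin n₁ → Fin n₂ → Set
  IsLeftX x y = Adj x y × (∀ y' → Adj x y' → y ≤ y')

  IsRightX : Fin n₁ → Fin n₂ → Set
  IsRightX x y = Adj x y × (∀ y' → Adj x y' → y' ≤ y)

  IsRightY : Fin n₂ → Fin n₁ → Set
  IsRightY y x = Adj x y × (∀ x' → Adj x' y → x' ≤ x)

  LexConvex : Set
  LexConvex = ConvexOrder ×
    (∀ (i j : Fin n₁) → i < j →
      ∀ li lj ri rj → IsLeftX i li → IsLeftX j lj → IsRightX i ri → IsRightX j rj →
      li < lj ⊎ (li ≡ lj × ri ≤ rj))

  -- Membership in J₁, the first set of isolated vertices of the chain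
  -- decomposition, where y₁ is the first vertex of Y and xr = right(y₁).
  -- V(H₁) = N(y₁) ∪ N(xr) (N(y₁) ⊆ X, N(xr) ⊆ Y); x ∈ J₁ iff x ∈ X ∖ V(H₁)
  -- and every neighbour of x lies in V(H₁), i.e. in N(xr).
  InJ₁ : (y₁ : Fin n₂) (xr : Fin n₁) → Fin n₁ → Set
  InJ₁ y₁ xr x = ¬ Adj x y₁ × (∀ y → Adj x y → Adj xr y)

  -- A set D ⊆ X ∪ Y, represented by its parts DX ⊆ X and DY ⊆ Y.
  -- D is a VED-set: every edge xy has (N[x] ∪ N[y]) ∩ D ≠ ∅.
  IsVED : Subset n₁ → Subset n₂ → Set
  IsVED DX DY = ∀ x y → Adj x y →
    (x ∈ DX) ⊎ (y ∈ DY) ⊎ (∃ λ y' → Adj x y' × y' ∈ DY) ⊎ (∃ λ x' → Adj x' y × x' ∈ DX)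

  size : Subset n₁ → Subset n₂ → ℕ
  size DX DY = ∣ DX ∣ + ∣ DY ∣

  IsMinVED : Subset n₁ → Subset n₂ → Set
  IsMinVED DX DY = IsVED DX DY ×
    (∀ DX' DY' → IsVED DX' DY' → size DX DY Data.Nat.≤ size DX' DY')

-- The edge x₁y₁ forces a minimum VED-set D to contain a vertex covering it.
-- Lex-convexity makes the neighbourhoods of the vertices of N(y₁) nested
-- initial segments of Y, the largest being N(x_r) and the smallest N(x₁).
-- An x ∈ D adjacent to y₁ can thus be traded for x_r.  Otherwise D contains
-- some y_j ∈ N(x₁) ⊆ N(x_r).  If all of J₁ is adjacent to y_j, then every
-- neighbour of y_j is adjacent to y_α (it is either in N(y₁), in J₁, or has a
-- neighbour beyond N(x_r), hence beyond y_α ≥ y_j), and y_j is traded for y_α.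
-- If some x ∈ J₁ misses y_j, the edge at x is covered either by a second
-- vertex of D ∩ N(x_r), or by some x' ∈ D adjacent to N(x_r); in both cases a
-- vertex of D can be exchanged for x_r without growing D.
module Submission where

open import Defs
open import Data.Nat using (ℕ; suc)
open import Data.Fin using (Fin; zero; _≤_)
open import Data.Fin.Subset using (Subset; _∈_)
open import Data.Product using (_×_; ∃₂; ∃)
open import Data.Sum using (_⊎_)

open import Level using (Level)
open import Data.Bool using (true; false)
open import Data.Bool.Properties using (T?)
open import Data.Empty using (⊥-elim)
open import Data.Fin using (_≟_) renaming (suc to fsuc)
import Data.Fin.Properties as Finₚ
open import Data.Fin.Subset using (∣_∣; ⊤; ⁅_⁆; _∪_; _-_)
open import Data.Fin.Subset.Properties
  using (_∈?_; anySubset?; ∈⊤; x∈⁅x⁆; ∣⁅x⁆∣≡1; ∣p∣≤∣x∷p∣; p⊆p∪q; q⊆p∪q; x∈p∧x≢y⇒x∈p-y; x∈p⇒∣p-x∣<∣p∣)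
import Data.Nat as ℕ
import Data.Nat.Properties as ℕₚ
open import Data.Nat.Induction using (<-wellFounded)
open import Data.Product using (_,_; proj₁; proj₂)
open import Data.Sum using (inj₁; inj₂)
open import Data.Vec using ([]; _∷_)
open import Induction.WellFounded using (Acc; acc)
open import Relation.Nullary using (¬_; Dec; yes; no)
open import Relation.Nullary.Decidable using (_×-dec_; _⊎-dec_; _→-dec_; ¬?; map′)
open import Relation.Unary using (Pred; Decidable)
open import Relation.Binary.PropositionalEquality using (_≡_; _≢_; refl; sym; trans; cong; subst)
open import Relation.Binary.Construct.Closure.ReflexiveTransitive using (Star; ε; _◅_)

private
  variable
    a ℓ : Level
    n : ℕ

∣p∪q∣≤∣p∣+∣q∣ : (p q : Subset n) → ∣ p ∪ q ∣ ℕ.≤ ∣ p ∣ ℕ.+ ∣ q ∣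
∣p∪q∣≤∣p∣+∣q∣ [] [] = ℕ.z≤n
∣p∪q∣≤∣p∣+∣q∣ (true ∷ p) (b ∷ q) =
  ℕ.s≤s (ℕₚ.≤-trans (∣p∪q∣≤∣p∣+∣q∣ p q) (ℕₚ.+-monoʳ-≤ ∣ p ∣ (∣p∣≤∣x∷p∣ b q)))
∣p∪q∣≤∣p∣+∣q∣ (false ∷ p) (true ∷ q) =
  ℕₚ.≤-trans (ℕ.s≤s (∣p∪q∣≤∣p∣+∣q∣ p q)) (ℕₚ.≤-reflexive (sym (ℕₚ.+-suc ∣ p ∣ ∣ q ∣)))
∣p∪q∣≤∣p∣+∣q∣ (false ∷ p) (false ∷ q) = ∣p∪q∣≤∣p∣+∣q∣ p q

∣p∪⁅x⁆∣≤1+∣p∣ : (p : Subset n) (x : Fin n) → ∣ p ∪ ⁅ x ⁆ ∣ ℕ.≤ suc ∣ p ∣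
∣p∪⁅x⁆∣≤1+∣p∣ p x = ℕₚ.≤-trans (∣p∪q∣≤∣p∣+∣q∣ p ⁅ x ⁆)
  (ℕₚ.≤-reflexive (trans (cong (∣ p ∣ ℕ.+_) (∣⁅x⁆∣≡1 x)) (ℕₚ.+-comm ∣ p ∣ 1)))

∣p-x∪⁅y⁆∣≤∣p∣ : {p : Subset n} {x : Fin n} (y : Fin n) → x ∈ p → ∣ (p - x) ∪ ⁅ y ⁆ ∣ ℕ.≤ ∣ p ∣
∣p-x∪⁅y⁆∣≤∣p∣ {p = p} {x} y x∈p = ℕₚ.≤-trans (∣p∪⁅x⁆∣≤1+∣p∣ (p - x) y) (x∈p⇒∣p-x∣<∣p∣ x∈p)

x∈p-y∪q : {p : Subset n} {x y : Fin n} (q : Subset n) → x ∈ p → x ≢ y → x ∈ (p - y) ∪ q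
x∈p-y∪q q x∈p x≢y = p⊆p∪q q (x∈p∧x≢y⇒x∈p-y x∈p x≢y)

y∈p∪⁅y⁆ : (p : Subset n) (y : Fin n) → y ∈ p ∪ ⁅ y ⁆
y∈p∪⁅y⁆ p y = q⊆p∪q p ⁅ y ⁆ (x∈⁅x⁆ y)

trade-≤ : ∀ {k l m n} → k ℕ.≤ suc l → m ℕ.< n → k ℕ.+ m ℕ.≤ l ℕ.+ n
trade-≤ {k} {l} {m} {n} k≤1+l m<n = begin
  k ℕ.+ m       ≤⟨ ℕₚ.+-monoˡ-≤ m k≤1+l ⟩
  suc l ℕ.+ m   ≡⟨ sym (ℕₚ.+-suc l m) ⟩
  l ℕ.+ suc m   ≤⟨ ℕₚ.+-monoʳ-≤ l m<n ⟩
  l ℕ.+ n       ∎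
  where open ℕₚ.≤-Reasoning

Greatest : Pred (Fin n) ℓ → Set ℓ
Greatest P = ∃ λ m → P m × (∀ i → P i → i ≤ m)

Least : Pred (Fin n) ℓ → Set ℓ
Least P = ∃ λ m → P m × (∀ i → P i → m ≤ i)

search-greatest : {P : Pred (Fin n) ℓ} → Decidable P → (∀ i → ¬ P i) ⊎ Greatest P
search-greatest {n = ℕ.zero} P? = inj₁ (λ ())
search-greatest {n = suc n} P? with search-greatest (λ i → P? (fsuc i))
... | inj₂ (m , Pm , max) =
  inj₂ (fsuc m , Pm , λ { zero _ → ℕ.z≤n ; (fsuc i) Pi → ℕ.s≤s (max i Pi) })
... | inj₁ none with P? zero
...   | yes P0 = inj₂ (zero , P0 , λ { zero _ → ℕ.z≤n ; (fsuc i) Pi → ⊥-elim (none i Pi) })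
...   | no ¬P0 = inj₁ (λ { zero → ¬P0 ; (fsuc i) → none i })

search-least : {P : Pred (Fin n) ℓ} → Decidable P → (∀ i → ¬ P i) ⊎ Least P
search-least {n = ℕ.zero} P? = inj₁ (λ ())
search-least {n = suc n} P? with P? zero
... | yes P0 = inj₂ (zero , P0 , λ _ _ → ℕ.z≤n)
... | no ¬P0 with search-least (λ i → P? (fsuc i))
...   | inj₁ none = inj₁ (λ { zero → ¬P0 ; (fsuc i) → none i })
...   | inj₂ (m , Pm , min) =
  inj₂ (fsuc m , Pm , λ { zero P0 → ⊥-elim (¬P0 P0) ; (fsuc i) Pi → ℕ.s≤s (min i Pi) })

⊆-or-counterexample : {P Q : Pred (Fin n) ℓ} → Decidable P → Decidable Q →
  (∀ i → P i → Q i) ⊎ ∃ λ i → P i × ¬ Q i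
⊆-or-counterexample {n = n} {P = P} {Q} P? Q? with Finₚ.all? (λ i → P? i →-dec Q? i)
... | yes P⊆Q = inj₁ P⊆Q
... | no P⊈Q with Finₚ.¬∀⟶∃¬ n (λ i → P i → Q i) (λ i → P? i →-dec Q? i) P⊈Q
...   | i , ¬[Pi→Qi] with P? i
...     | yes Pi = inj₂ (i , Pi , λ Qi → ¬[Pi→Qi] (λ _ → Qi))
...     | no ¬Pi = ⊥-elim (¬[Pi→Qi] (λ Pi → ⊥-elim (¬Pi Pi)))

module _ {A : Set a} {P : Pred A ℓ} (f : A → ℕ)
         (smaller? : ∀ x → Dec (∃ λ y → P y × f y ℕ.< f x)) where

  minimiser : ∀ {x} → P x → ∃ λ y → P y × (∀ z → P z → f y ℕ.≤ f z)
  minimiser {x} = descend x (<-wellFounded (f x))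
    where
    descend : ∀ x → Acc ℕ._<_ (f x) → P x → ∃ λ y → P y × (∀ z → P z → f y ℕ.≤ f z)
    descend x (acc rec) Px with smaller? x
    ... | yes (y , Py , fy<fx) = descend y (rec fy<fx) Py
    ... | no none = x , Px , λ z Pz → ℕₚ.≮⇒≥ (λ fz<fx → none (z , Pz , fz<fx))

module Neighbourhood {n₁ n₂ : ℕ} (G : BGraph n₁ n₂) where

  adj? : ∀ x y → Dec (Adj G x y)
  adj? x y = T? (G x y)

  right-exists : ∀ {x y} → Adj G x y → ∃ (IsRightX G x)
  right-exists {x} xy with search-greatest (adj? x)
  ... | inj₁ none = ⊥-elim (none _ xy)
  ... | inj₂ right = right

  left-exists : ∀ {x y} → Adj G x y → ∃ (IsLeftX G x)
  left-exists {x} xy with search-least (adj? x)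
  ... | inj₁ none = ⊥-elim (none _ xy)
  ... | inj₂ left = left

  connected⇒neighbour : Connected G → Fin n₂ → ∀ x → ∃ (Adj G x)
  connected⇒neighbour conn y x = first-edge (conn (inj₁ x) (inj₂ y)) refl
    where
    first-edge : ∀ {v} → Star (Edge G) (inj₁ x) v → v ≡ inj₂ y → ∃ (Adj G x)
    first-edge ε ()
    first-edge (_◅_ {j = inj₁ _} () _) _
    first-edge (_◅_ {j = inj₂ y'} xy' _) _ = y' , xy'

module Domination {n₁ n₂ : ℕ} (G : BGraph n₁ n₂) where

  open Neighbourhood G using (adj?)

  private
    variable
      x x' x* u v : Fin n₁
      y y' y'' y* : Fin n₂
      DX DX' : Subset n₁
      DY DY' : Subset n₂

  -- For an edge xy, a vertex of N[x] ∪ N[y] is either some x' ∼ y or some y' ∼ x.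
  Covered : Subset n₁ → Subset n₂ → Fin n₁ → Fin n₂ → Set
  Covered DX DY x y = (∃ λ x' → x' ∈ DX × Adj G x' y) ⊎ (∃ λ y' → y' ∈ DY × Adj G x y')

  IsCover : Subset n₁ → Subset n₂ → Set
  IsCover DX DY = ∀ x y → Adj G x y → Covered DX DY x y

  IsVED⇒IsCover : IsVED G DX DY → IsCover DX DY
  IsVED⇒IsCover ved x y xy with ved x y xy
  ... | inj₁ x∈DX = inj₁ (x , x∈DX , xy)
  ... | inj₂ (inj₁ y∈DY) = inj₂ (y , y∈DY , xy)
  ... | inj₂ (inj₂ (inj₁ (y' , xy' , y'∈DY))) = inj₂ (y' , y'∈DY , xy')
  ... | inj₂ (inj₂ (inj₂ (x' , x'y , x'∈DX))) = inj₁ (x' , x'∈DX , x'y)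

  IsCover⇒IsVED : IsCover DX DY → IsVED G DX DY
  IsCover⇒IsVED cover x y xy with cover x y xy
  ... | inj₁ (x' , x'∈DX , x'y) = inj₂ (inj₂ (inj₂ (x' , x'y , x'∈DX)))
  ... | inj₂ (y' , y'∈DY , xy') = inj₂ (inj₂ (inj₁ (y' , xy' , y'∈DY)))

  isVED? : ∀ DX DY → Dec (IsVED G DX DY)
  isVED? DX DY = map′ IsCover⇒IsVED IsVED⇒IsCover
    (Finₚ.all? λ x → Finₚ.all? λ y → adj? x y →-dec
      (Finₚ.any? (λ x' → x' ∈? DX ×-dec adj? x' y) ⊎-dec Finₚ.any? (λ y' → y' ∈? DY ×-dec adj? x y')))

  minVED-exists : ∃₂ λ DX DY → IsMinVED G DX DY
  minVED-exists with minimiser size′ smaller? {⊤ , ⊤} (λ _ _ _ → inj₁ ∈⊤)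
    where
    size′ : Subset n₁ × Subset n₂ → ℕ
    size′ (DX , DY) = size G DX DY
    smaller? : ∀ D → Dec (∃ λ D' → IsVED G (proj₁ D') (proj₂ D') × size′ D' ℕ.< size′ D)
    smaller? D = map′ (λ (DX' , DY' , smaller) → (DX' , DY') , smaller)
                      (λ ((DX' , DY') , smaller) → DX' , DY' , smaller)
      (anySubset? λ DX' → anySubset? λ DY' → isVED? DX' DY' ×-dec (size G DX' DY' ℕₚ.<? size′ D))
  ... | (DX , DY) , ved , min = DX , DY , ved , λ DX' DY' ved' → min (DX' , DY') ved'

  -- A vertex x' ∈ D covers exactly the edges at the neighbours of x',
  -- and y' ∈ D the edges at the neighbours of y'.
  exchange : IsMinVED G DX DY → size G DX' DY' ℕ.≤ size G DX DY →
    (∀ {x' y} → x' ∈ DX → Adj G x' y → ∃ λ x'' → x'' ∈ DX' × Adj G x'' y) →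
    (∀ {y' x y} → y' ∈ DY → Adj G x y' → Adj G x y → Covered DX' DY' x y) →
    IsMinVED G DX' DY'
  exchange (ved , min) size≤ keepX keepY =
    IsCover⇒IsVED cover , λ DX'' DY'' ved'' → ℕₚ.≤-trans size≤ (min DX'' DY'' ved'')
    where
    cover : IsCover _ _
    cover x y xy with IsVED⇒IsCover ved x y xy
    ... | inj₁ (x' , x'∈DX , x'y) = inj₁ (keepX x'∈DX x'y)
    ... | inj₂ (y' , y'∈DY , xy') = keepY y'∈DY xy' xy

  replaceX : IsMinVED G DX DY → x ∈ DX → (∀ {y} → Adj G x y → Adj G x* y) →
    IsMinVED G ((DX - x) ∪ ⁅ x* ⁆) DY
  replaceX {DX = DX} {DY} {x} {x*} min x∈DX Nx⊆Nx* =
    exchange min (ℕₚ.+-monoˡ-≤ ∣ DY ∣ (∣p-x∪⁅y⁆∣≤∣p∣ x* x∈DX)) keepX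
      (λ y'∈DY xy' _ → inj₂ (_ , y'∈DY , xy'))
    where
    keepX : x' ∈ DX → Adj G x' y → ∃ λ x'' → x'' ∈ (DX - x) ∪ ⁅ x* ⁆ × Adj G x'' y
    keepX {x'} x'∈DX x'y with x' ≟ x
    ... | yes refl = x* , y∈p∪⁅y⁆ (DX - x) x* , Nx⊆Nx* x'y
    ... | no x'≢x = x' , x∈p-y∪q ⁅ x* ⁆ x'∈DX x'≢x , x'y

  replaceY : IsMinVED G DX DY → y ∈ DY → (∀ {x} → Adj G x y → Adj G x y*) →
    IsMinVED G DX ((DY - y) ∪ ⁅ y* ⁆)
  replaceY {DX = DX} {DY} {y} {y*} min y∈DY Ny⊆Ny* =
    exchange min (ℕₚ.+-monoʳ-≤ ∣ DX ∣ (∣p-x∪⁅y⁆∣≤∣p∣ y* y∈DY)) (λ x'∈DX x'y → _ , x'∈DX , x'y) keepY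
    where
    keepY : y' ∈ DY → Adj G x y' → Adj G x y'' → Covered DX ((DY - y) ∪ ⁅ y* ⁆) x y''
    keepY {y'} y'∈DY xy' _ with y' ≟ y
    ... | yes refl = inj₂ (y* , y∈p∪⁅y⁆ (DY - y) y* , Ny⊆Ny* xy')
    ... | no y'≢y = inj₂ (y' , x∈p-y∪q ⁅ y* ⁆ y'∈DY y'≢y , xy')

  replaceY-byX : IsMinVED G DX DY → y ∈ DY →
    (∀ {x y''} → Adj G x y → Adj G x y'' → Covered (DX ∪ ⁅ x* ⁆) (DY - y) x y'') →
    IsMinVED G (DX ∪ ⁅ x* ⁆) (DY - y)
  replaceY-byX {DX = DX} {DY} {y} {x*} min y∈DY coverNy =
    exchange min (trade-≤ (∣p∪⁅x⁆∣≤1+∣p∣ DX x*) (x∈p⇒∣p-x∣<∣p∣ y∈DY))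
      (λ x'∈DX x'y → _ , p⊆p∪q ⁅ x* ⁆ x'∈DX , x'y) keepY
    where
    keepY : y' ∈ DY → Adj G x y' → Adj G x y'' → Covered (DX ∪ ⁅ x* ⁆) (DY - y) x y''
    keepY {y'} y'∈DY xy' xy'' with y' ≟ y
    ... | yes refl = coverNy xy' xy''
    ... | no y'≢y = inj₂ (y' , x∈p∧x≢y⇒x∈p-y y'∈DY y'≢y , xy')

  replaceXY-byXX : IsMinVED G DX DY → x ∈ DX → y ∈ DY →
    (∀ {y''} → Adj G x y'' → Adj G u y'' ⊎ Adj G v y'') →
    (∀ {x' y''} → Adj G x' y → Adj G x' y'' → Adj G u y'' ⊎ Adj G v y'') →
    IsMinVED G (((DX - x) ∪ ⁅ u ⁆) ∪ ⁅ v ⁆) (DY - y)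
  replaceXY-byXX {DX = DX} {DY} {x} {y} {u} {v} min x∈DX y∈DY Nx⊆Nu∪Nv NNy⊆Nu∪Nv =
    exchange min (trade-≤ size≤ (x∈p⇒∣p-x∣<∣p∣ y∈DY)) keepX keepY
    where
    DX′ : Subset n₁
    DX′ = ((DX - x) ∪ ⁅ u ⁆) ∪ ⁅ v ⁆
    size≤ : ∣ DX′ ∣ ℕ.≤ suc ∣ DX ∣
    size≤ = ℕₚ.≤-trans (∣p∪⁅x⁆∣≤1+∣p∣ ((DX - x) ∪ ⁅ u ⁆) v) (ℕ.s≤s (∣p-x∪⁅y⁆∣≤∣p∣ u x∈DX))
    u-or-v : Adj G u y'' ⊎ Adj G v y'' → ∃ λ x'' → x'' ∈ DX′ × Adj G x'' y''
    u-or-v (inj₁ uy'') = u , p⊆p∪q ⁅ v ⁆ (y∈p∪⁅y⁆ (DX - x) u) , uy''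
    u-or-v (inj₂ vy'') = v , y∈p∪⁅y⁆ _ v , vy''
    keepX : x' ∈ DX → Adj G x' y'' → ∃ λ x'' → x'' ∈ DX′ × Adj G x'' y''
    keepX {x'} x'∈DX x'y'' with x' ≟ x
    ... | yes refl = u-or-v (Nx⊆Nu∪Nv x'y'')
    ... | no x'≢x = x' , p⊆p∪q ⁅ v ⁆ (x∈p-y∪q ⁅ u ⁆ x'∈DX x'≢x) , x'y''
    keepY : y' ∈ DY → Adj G x' y' → Adj G x' y'' → Covered DX′ (DY - y) x' y''
    keepY {y'} y'∈DY x'y' x'y'' with y' ≟ y
    ... | yes refl = inj₁ (u-or-v (NNy⊆Nu∪Nv x'y' x'y''))
    ... | no y'≢y = inj₂ (y' , x∈p∧x≢y⇒x∈p-y y'∈DY y'≢y , x'y')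

module LexConvexOrdering {m₁ m₂ : ℕ} (G : BGraph (suc m₁) (suc m₂)) (LC : LexConvex G) where

  open Neighbourhood G

  private
    variable
      x x' : Fin (suc m₁)
      y y' : Fin (suc m₂)

  convex : ConvexOrder G
  convex = proj₁ LC

  -- All vertices of N(y₁) share the left end y₁, so lex-convexity orders their right ends.
  nested-neighbourhoods : x ≤ x' → Adj G x zero → Adj G x' zero → Adj G x y → Adj G x' y
  nested-neighbourhoods {x} {x'} {y} x≤x' xy₁ x'y₁ xy with x ≟ x'
  ... | yes refl = xy
  ... | no x≢x' with right-exists xy | right-exists x'y₁
  ...   | right[x] , is-right[x] | right[x'] , is-right[x']
        with proj₂ LC x x' (Finₚ.≤∧≢⇒< x≤x' x≢x') zero zero right[x] right[x']
               (xy₁ , λ _ _ → ℕ.z≤n) (x'y₁ , λ _ _ → ℕ.z≤n) is-right[x] is-right[x']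
  ...     | inj₁ ()
  ...     | inj₂ (_ , right[x]≤right[x']) =
    convex x' ℕ.z≤n (ℕₚ.≤-trans (proj₂ is-right[x] y xy) right[x]≤right[x']) x'y₁ (proj₁ is-right[x'])

  neighbour≤non-neighbour : Adj G x zero → Adj G x y → ¬ Adj G x y' → y ≤ y'
  neighbour≤non-neighbour {x} {y} {y'} xy₁ xy ¬xy' with Finₚ.≤-total y y'
  ... | inj₁ y≤y' = y≤y'
  ... | inj₂ y'≤y = ⊥-elim (¬xy' (convex x ℕ.z≤n y'≤y xy₁ xy))

module Proof {m₁ m₂ : ℕ} (G : BGraph (suc m₁) (suc m₂)) (conn : Connected G) (LC : LexConvex G)
  {r' : Fin (suc m₂)} {r : Fin (suc m₁)} (hr' : IsRightX G zero r') (hr : IsRightY G zero r) where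

  open Neighbourhood G
  open Domination G
  open LexConvexOrdering G LC

  private
    variable
      x x' : Fin (suc m₁)
      y y' j : Fin (suc m₂)
      DX : Subset (suc m₁)
      DY : Subset (suc m₂)

  ContainsXr : Set
  ContainsXr = ∃₂ λ DX DY → IsMinVED G DX DY × r ∈ DX

  Candidate : Fin (suc m₂) → Set
  Candidate i = i ≤ r' × (∀ x → InJ₁ G zero r x → Adj G x i)

  ContainsYα : Set
  ContainsYα = ∃ λ α → α ≤ r' × (∀ x → InJ₁ G zero r x → Adj G x α)
    × (∀ i → i ≤ r' → (∀ x → InJ₁ G zero r x → Adj G x i) → i ≤ α)
    × Adj G zero α
    × ∃₂ λ DX DY → IsMinVED G DX DY × α ∈ DY

  xr∼y₁ : Adj G r zero
  xr∼y₁ = proj₁ hr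

  -- left(x₁) ⪯ left(x_r) = y₁
  x₁∼y₁ : Adj G zero zero
  x₁∼y₁ with zero ≟ r
  ... | yes x₁≡r = subst (λ x → Adj G x zero) (sym x₁≡r) xr∼y₁
  ... | no x₁≢r with left-exists (proj₁ hr') | right-exists xr∼y₁
  ...   | left[x₁] , is-left[x₁] | right[xr] , is-right[xr]
        with proj₂ LC zero r (Finₚ.≤∧≢⇒< ℕ.z≤n x₁≢r) left[x₁] zero r' right[xr]
               is-left[x₁] (xr∼y₁ , λ _ _ → ℕ.z≤n) hr' is-right[xr]
  ...     | inj₁ ()
  ...     | inj₂ (left[x₁]≡y₁ , _) = subst (Adj G zero) left[x₁]≡y₁ (proj₁ is-left[x₁])

  Nx⊆Nxr : Adj G x zero → Adj G x y → Adj G r y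
  Nx⊆Nxr xy₁ = nested-neighbourhoods (proj₂ hr _ xy₁) xy₁ xr∼y₁

  Nx₁⊆Nx : Adj G x zero → Adj G zero y → Adj G x y
  Nx₁⊆Nx xy₁ = nested-neighbourhoods ℕ.z≤n x₁∼y₁ xy₁

  inJ₁? : Decidable (InJ₁ G zero r)
  inJ₁? x = ¬? (adj? x zero) ×-dec Finₚ.all? (λ y → adj? x y →-dec adj? r y)

  covered-by-xr-or : (¬ Adj G r y → Covered (DX ∪ ⁅ r ⁆) DY x y) → Covered (DX ∪ ⁅ r ⁆) DY x y
  covered-by-xr-or {y = y} {DX = DX} cover with adj? r y
  ... | yes ry = inj₁ (r , y∈p∪⁅y⁆ DX r , ry)
  ... | no ¬ry = cover ¬ry

  trade-for-xr : IsMinVED G DX DY → j ∈ DY →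
    (∀ {x y} → Adj G x j → Adj G x y → ¬ Adj G r y → Covered (DX ∪ ⁅ r ⁆) (DY - j) x y) →
    ContainsXr
  trade-for-xr {DX = DX} min j∈DY cover =
    _ , _ , replaceY-byX min j∈DY (λ xj xy → covered-by-xr-or (cover xj xy)) , y∈p∪⁅y⁆ DX r

  ordered-pair-in-Nxr : IsMinVED G DX DY → y ∈ DY → y' ∈ DY → Adj G r y' → y ≢ y' → y ≤ y' →
    ContainsXr
  ordered-pair-in-Nxr {y = y} {y'} min y∈DY y'∈DY ry' y≢y' y≤y' = trade-for-xr min y∈DY
    λ xy xz ¬rz → inj₂ (y' , x∈p∧x≢y⇒x∈p-y y'∈DY (λ y'≡y → y≢y' (sym y'≡y)) ,
                         convex _ y≤y' (neighbour≤non-neighbour xr∼y₁ ry' ¬rz) xy xz)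

  pair-in-Nxr : IsMinVED G DX DY → y ∈ DY → y' ∈ DY → Adj G r y → Adj G r y' → y ≢ y' → ContainsXr
  pair-in-Nxr {y = y} {y'} min y∈DY y'∈DY ry ry' y≢y' with Finₚ.≤-total y y'
  ... | inj₁ y≤y' = ordered-pair-in-Nxr min y∈DY y'∈DY ry' y≢y' y≤y'
  ... | inj₂ y'≤y = ordered-pair-in-Nxr min y'∈DY y∈DY ry (λ y'≡y → y≢y' (sym y'≡y)) y'≤y

  Escape : Fin (suc m₂) → Fin (suc m₂) → Set
  Escape j y = ∃ λ x → Adj G x j × Adj G x y × ¬ Adj G r y

  escape? : ∀ j → Decidable (Escape j)
  escape? j y = Finₚ.any? λ x → adj? x j ×-dec adj? x y ×-dec ¬? (adj? r y)

  -- Let y_m be the last escape of y_j, through x_c; as N(x_c) is an interval from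
  -- y_j to y_m, x_c covers every escape.  If x' ∼ y_m then x' does so too; else
  -- N(x') ends before y_m, so x' is covered by x_r and x_c.
  edge-into-Nxr : IsMinVED G DX DY → x' ∈ DX → Adj G x' y → Adj G r y → j ∈ DY → Adj G r j →
    ContainsXr
  edge-into-Nxr {DX = DX} {x' = x'} {y} {j} min x'∈DX x'y ry j∈DY rj with search-greatest (escape? j)
  ... | inj₁ none = trade-for-xr min j∈DY λ xj xz ¬rz → ⊥-elim (none _ (_ , xj , xz , ¬rz))
  ... | inj₂ (m , (xc , xcj , xcm , ¬rm) , last) with adj? x' m
  ...   | yes x'm = trade-for-xr min j∈DY λ xj xz ¬rz →
          inj₁ (x' , p⊆p∪q ⁅ r ⁆ x'∈DX ,
                convex x' (neighbour≤non-neighbour xr∼y₁ ry ¬rz) (last _ (_ , xj , xz , ¬rz)) x'y x'm)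
  ...   | no ¬x'm = _ , _ , replaceXY-byXX min x'∈DX j∈DY Nx'⊆ NNj⊆ , p⊆p∪q ⁅ xc ⁆ (y∈p∪⁅y⁆ (DX - x') r)
    where
    Nx'⊆ : ∀ {z} → Adj G x' z → Adj G r z ⊎ Adj G xc z
    Nx'⊆ {z} x'z with adj? r z
    ... | yes rz = inj₁ rz
    ... | no ¬rz with Finₚ.≤-total z m
    ...   | inj₁ z≤m = inj₂ (convex xc (neighbour≤non-neighbour xr∼y₁ rj ¬rz) z≤m xcj xcm)
    ...   | inj₂ m≤z = ⊥-elim (¬x'm (convex x' (neighbour≤non-neighbour xr∼y₁ ry ¬rm) m≤z x'y x'z))
    NNj⊆ : ∀ {x z} → Adj G x j → Adj G x z → Adj G r z ⊎ Adj G xc z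
    NNj⊆ {z = z} xj xz with adj? r z
    ... | yes rz = inj₁ rz
    ... | no ¬rz =
      inj₂ (convex xc (neighbour≤non-neighbour xr∼y₁ rj ¬rz) (last z (_ , xj , xz , ¬rz)) xcj xcm)

  candidate? : Decidable Candidate
  candidate? i = i Finₚ.≤? r' ×-dec Finₚ.all? (λ x → inJ₁? x →-dec adj? x i)

  trade-for-yα : IsMinVED G DX DY → j ∈ DY → Adj G zero j → (∀ x → InJ₁ G zero r x → Adj G x j) →
    ContainsYα
  trade-for-yα {DY = DY} {j} min j∈DY x₁j J₁⊆Nj with search-greatest candidate?
  ... | inj₁ none = ⊥-elim (none j (proj₂ hr' j x₁j , J₁⊆Nj))
  ... | inj₂ (α , (α≤r' , J₁⊆Nα) , greatest) =
    α , α≤r' , J₁⊆Nα , (λ i i≤r' J₁⊆Ni → greatest i (i≤r' , J₁⊆Ni)) , x₁α ,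
    _ , _ , replaceY min j∈DY Nj⊆Nα , y∈p∪⁅y⁆ (DY - j) α
    where
    x₁α : Adj G zero α
    x₁α = convex zero ℕ.z≤n α≤r' x₁∼y₁ (proj₁ hr')
    Nj⊆Nα : ∀ {x} → Adj G x j → Adj G x α
    Nj⊆Nα {x} xj with adj? x zero
    ... | yes xy₁ = Nx₁⊆Nx xy₁ x₁α
    ... | no ¬xy₁ with ⊆-or-counterexample (adj? x) (adj? r)
    ...   | inj₁ Nx⊆Nr = J₁⊆Nα x (¬xy₁ , Nx⊆Nr)
    ...   | inj₂ (y , xy , ¬ry) =
      convex x (greatest j (proj₂ hr' j x₁j , J₁⊆Nj))
        (neighbour≤non-neighbour xr∼y₁ (Nx⊆Nxr x₁∼y₁ x₁α) ¬ry) xj xy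

  J₁-vertex-off-yj : IsMinVED G DX DY → j ∈ DY → Adj G r j → InJ₁ G zero r x → ¬ Adj G x j →
    ContainsXr
  J₁-vertex-off-yj {x = x} min j∈DY rj (_ , Nx⊆Nr) ¬xj with connected⇒neighbour conn zero x
  ... | y , xy with IsVED⇒IsCover (proj₁ min) x y xy
  ...   | inj₁ (x' , x'∈DX , x'y) = edge-into-Nxr min x'∈DX x'y (Nx⊆Nr y xy) j∈DY rj
  ...   | inj₂ (y' , y'∈DY , xy') =
    pair-in-Nxr min j∈DY y'∈DY rj (Nx⊆Nr y' xy') (λ j≡y' → ¬xj (subst (Adj G x) (sym j≡y') xy'))

  via-Nx₁ : IsMinVED G DX DY → j ∈ DY → Adj G zero j → ContainsXr ⊎ ContainsYα
  via-Nx₁ {j = j} min j∈DY x₁j with ⊆-or-counterexample inJ₁? (λ x → adj? x j)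
  ... | inj₁ J₁⊆Nj = inj₂ (trade-for-yα min j∈DY x₁j J₁⊆Nj)
  ... | inj₂ (x , x∈J₁ , ¬xj) = inj₁ (J₁-vertex-off-yj min j∈DY (Nx⊆Nxr x₁∼y₁ x₁j) x∈J₁ ¬xj)

  theorem : ContainsXr ⊎ ContainsYα
  theorem with minVED-exists
  ... | DX , DY , min with IsVED⇒IsCover (proj₁ min) zero zero x₁∼y₁
  ...   | inj₁ (x , x∈DX , xy₁) = inj₁ (_ , _ , replaceX min x∈DX (Nx⊆Nxr xy₁) , y∈p∪⁅y⁆ (DX - x) r)
  ...   | inj₂ (y , y∈DY , x₁y) = via-Nx₁ min y∈DY x₁y

lemma2 : ∀ {m₁ m₂ : ℕ} (G : BGraph (suc m₁) (suc m₂)) →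
    Connected G → LexConvex G →
    ∀ (r' : Fin (suc m₂)) (r : Fin (suc m₁)) →
    IsRightX G zero r' → IsRightY G zero r →
    (∃₂ λ DX DY → IsMinVED G DX DY × r ∈ DX)
    ⊎
    (∃ λ α → α ≤ r' × (∀ x → InJ₁ G zero r x → Adj G x α)
      × (∀ i → i ≤ r' → (∀ x → InJ₁ G zero r x → Adj G x i) → i ≤ α)
      × Adj G zero α
      × ∃₂ λ DX DY → IsMinVED G DX DY × α ∈ DY)
lemma2 G conn LC r' r hr' hr = Proof.theorem G conn LC hr' hr
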